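{- Let $N$ be a binary reticulation-visible phylogenetic network. Then one can choose, at each reticulation $r$ of $N$, exactly one of the two branches entering $r$, such that the graph obtained from $N$ by deleting all chosen branches is a spanning tree of $N$ containing no dummy leaves, i.e. every vertex of outdegree $0$ in the resulting tree is a leaf of $N$.
   Context: A phylogenetic network on a finite set $X$ of taxa is a directed acyclic graph with a single root (indegree $0$) such that its leaves (outdegree $0$) are in one-to-one correspondence with $X$, there is no vertex with both indegree one and outdegree one, and every vertex is reachable from the root. Edges are called branches. A reticulation is a vertex of indegree at least two and outdegree one; a tree vertex is a vertex of indegree one and outdegree at least two. The network is binary if the root has degree $2$, leaves have degree $1$, and all other vertices have degree $3$. A vertex $x$ is a stable ancestor of a vertex $v$ if $x$ lies on every directed path from the root to $v$; $x$ is stable if it is a stable ancestor of some leaf. A network is reticulation-visible if all its reticulations are stable. -}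

module Defs where

open import Data.Nat using (ℕ; zero; suc; _≤_; _+_)
open import Data.Fin using (Fin; _≟_)
open import Data.List using (List; length; filter; allFin)
open import Data.Bool using (Bool; true; false)
open import Data.Product using (Σ; ∃; ∃-syntax; _×_; _,_)
open import Data.Sum using (_⊎_)
open import Relation.Binary.PropositionalEquality using (_≡_; _≢_)
open import Relation.Nullary using (¬_)
open import Data.Empty using (⊥)
open import Data.Unit using (⊤)

record Digraph : Set where
  field
    n   : ℕ
    m   : ℕ
    src : Fin m → Fin n
    tgt : Fin m → Fin n

module _ (G : Digraph) where
  open Digraph G

  Simple : Set
  Simple = ∀ e f → src e ≡ src f → tgt e ≡ tgt f → e ≡ f

  data PathIn (K : Fin m → Set) : Fin n → Fin n → Set where
    []  : ∀ {u} → PathIn K u u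
    _∷_ : ∀ {w} (e : Fin m) → {K e} → PathIn K (tgt e) w → PathIn K (src e) w

  OnPath : ∀ {K u w} → Fin n → PathIn K u w → Set
  OnPath {u = u} x [] = x ≡ u
  OnPath x (e ∷ p) = x ≡ src e ⊎ OnPath x p

  AllEdges : Fin m → Set
  AllEdges _ = ⊤

  Path : Fin n → Fin n → Set
  Path = PathIn AllEdges

  indegIn : (Fin m → Bool) → Fin n → ℕ
  indegIn k v = length (filter (λ e → tgt e ≟ v) (filter (λ e → k e Data.Bool.≟ true) (allFin m)))
    where import Data.Bool

  outdegIn : (Fin m → Bool) → Fin n → ℕ
  outdegIn k v = length (filter (λ e → src e ≟ v) (filter (λ e → k e Data.Bool.≟ true) (allFin m)))
    where import Data.Bool

  allE : Fin m → Bool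
  allE _ = true

  indeg : Fin n → ℕ
  indeg = indegIn allE

  outdeg : Fin n → ℕ
  outdeg = outdegIn allE

  Acyclic : Set
  Acyclic = ∀ (v : Fin n) (e : Fin m) → src e ≡ v → ¬ Path (tgt e) v

  IsLeaf : Fin n → Set
  IsLeaf v = outdeg v ≡ 0

  IsReticulation : Fin n → Set
  IsReticulation v = 2 ≤ indeg v × outdeg v ≡ 1

  StableAncestor : Fin n → Fin n → Fin n → Set
  StableAncestor root x v = ∀ (p : Path root v) → OnPath x p

  IsStable : Fin n → Fin n → Set
  IsStable root x = ∃[ l ] (IsLeaf l × StableAncestor root x l)

-- Leaves (outdegree 0) play the role of the taxa.
record Network : Set where
  field
    G      : Digraph
  open Digraph G public
  field
    simple     : Simple G
    acyclic    : Acyclic G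
    root       : Fin n
    root-indeg : indeg G root ≡ 0
    unique-root : ∀ v → indeg G v ≡ 0 → v ≡ root
    no-deg2    : ∀ v → ¬ (indeg G v ≡ 1 × outdeg G v ≡ 1)
    reachable  : ∀ v → Path G root v

module _ (N : Network) where
  open Network N

  Binary : Set
  Binary = (outdeg G root ≡ 2)
         × (∀ v → IsLeaf G v → indeg G v ≡ 1)
         × (∀ v → v ≢ root → ¬ IsLeaf G v → indeg G v + outdeg G v ≡ 3)

  ReticulationVisible : Set
  ReticulationVisible = ∀ r → IsReticulation G r → IsStable G root r

  Kept : (Fin m → Bool) → Fin m → Set
  Kept del e = del e ≡ false

  keep : (Fin m → Bool) → Fin m → Bool
  keep del e = Data.Bool.not (del e)
    where import Data.Bool

  ValidChoice : (Fin m → Bool) → Set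
  ValidChoice del =
      (∀ e → del e ≡ true → IsReticulation G (tgt e))
    × (∀ r → IsReticulation G r →
         ∃[ e ] (tgt e ≡ r × del e ≡ true
                 × ∀ f → tgt f ≡ r → del f ≡ true → f ≡ e))

  SpanningTree : (Fin m → Bool) → Set
  SpanningTree del =
      indegIn G (keep del) root ≡ 0
    × (∀ v → v ≢ root → indegIn G (keep del) v ≡ 1)
    × (∀ v → PathIn G (Kept del) root v)

  NoDummyLeaves : (Fin m → Bool) → Set
  NoDummyLeaves del = ∀ v → outdegIn G (keep del) v ≡ 0 → IsLeaf G v

-- In a binary network every vertex other than the root and the leaves is a tree vertex
-- (indegree 1, outdegree 2) or a reticulation (indegree 2, outdegree 1), and visibility forces the
-- child of a reticulation to be a tree vertex or a leaf. Deleting one entering branch at each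
-- reticulation leaves every non-root vertex with a unique parent, so by acyclicity the rest is a
-- spanning tree; a dummy leaf can only appear at a tree vertex both of whose deleted out-branches
-- enter reticulations. It therefore suffices to delete branches with pairwise distinct sources.
-- Seen as an edge between its two parents, each reticulation lives in a multigraph of maximum
-- degree two, and such a multigraph always admits an injective choice of one endpoint per edge:
-- two edges sharing an endpoint are contracted into one, and the choice for the contracted edge
-- tells which of the two takes the shared endpoint.
module Submission where

open import Data.Bool as Bool using (Bool; true; false; not; if_then_else_)
open import Data.Bool.Properties using (not-injective; not-¬)
open import Data.Empty using (⊥; ⊥-elim)
open import Data.Fin using (Fin; _≟_)
open import Data.List using (List; []; _∷_; length; filter; allFin; map)
open import Data.List.Membership.Propositional using (_∈_; _∉_; find; lose)
open import Data.List.Membership.Propositional.Properties using (∈-allFin; ∈-map⁺; ∈-map⁻; ∈-filter⁺; ∈-filter⁻)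
open import Data.List.Properties using (length-tabulate; length-filter; filter-notAll)
open import Data.List.Relation.Binary.Subset.Propositional using (_⊆_)
open import Data.List.Relation.Binary.Subset.Propositional.Properties using (∷⁺ʳ; xs⊆x∷xs)
open import Data.List.Relation.Unary.All as All using ([]; _∷_)
open import Data.List.Relation.Unary.AllPairs using ([]; _∷_)
open import Data.List.Relation.Unary.Any as Any using (Any; here; there; any?)
open import Data.List.Relation.Unary.Unique.Propositional using (Unique)
import Data.List.Relation.Unary.Unique.Propositional.Properties as Unique
open import Data.Nat as ℕ using (ℕ; zero; suc; _+_; _≤_; _<_; _≤?_; z≤n; s≤s)
open import Data.Nat.Properties using (≤-refl; ≤-trans; ≤-antisym; ≤-reflexive; <-irrefl; 1+n≢0; module ≤-Reasoning)
open import Data.Product using (Σ; ∃; ∃₂; ∃-syntax; _×_; _,_; proj₁; proj₂; map₁; map₂)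
open import Data.Sum as Sum using (_⊎_; inj₁; inj₂)
open import Function using (_∘_; id)
open import Relation.Binary.Definitions using (DecidableEquality)
open import Relation.Binary.PropositionalEquality using (_≡_; _≢_; refl; sym; trans; cong; subst; subst₂; ≢-sym)
open import Relation.Nullary using (¬_; Dec; yes; no; does; ¬?)
open import Relation.Nullary.Decidable using (_⊎-dec_; _×-dec_; dec-true; dec-false)

open import Defs

does≡true⇒ : ∀ {P : Set} (P? : Dec P) → does P? ≡ true → P
does≡true⇒ (yes p) _ = p

module _ {A : Set} (_≟_ : DecidableEquality A) where

  Unique-⊆⇒length≤ : ∀ {xs ys : List A} → Unique xs → xs ⊆ ys → length xs ≤ length ys
  Unique-⊆⇒length≤ {[]} _ _ = z≤n
  Unique-⊆⇒length≤ {x ∷ xs} {ys} (x∉xs ∷ xs!) x∷xs⊆ys = begin-strict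
    length xs                           ≤⟨ Unique-⊆⇒length≤ xs! xs⊆ys-x ⟩
    length (filter (λ y → ¬? (y ≟ x)) ys) <⟨ filter-notAll (λ y → ¬? (y ≟ x)) ys x∈ys ⟩
    length ys                           ∎
    where
    open ≤-Reasoning
    x∈ys : Any (λ y → ¬ y ≢ x) ys
    x∈ys = Any.map (λ { refl y≢x → y≢x refl }) (x∷xs⊆ys (here refl))
    xs⊆ys-x : xs ⊆ filter (λ y → ¬? (y ≟ x)) ys
    xs⊆ys-x y∈ = ∈-filter⁺ (λ y → ¬? (y ≟ x)) (x∷xs⊆ys (there y∈)) (≢-sym (All.lookup x∉xs y∈))

  three-distinct⇒3≤length : ∀ {xs : List A} {a b c} → a ≢ b → a ≢ c → b ≢ c →
                             a ∈ xs → b ∈ xs → c ∈ xs → 3 ≤ length xs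
  three-distinct⇒3≤length a≢b a≢c b≢c a∈ b∈ c∈ =
    Unique-⊆⇒length≤ ((a≢b ∷ a≢c ∷ []) ∷ (b≢c ∷ []) ∷ [] ∷ []) λ where
      (here refl)                 → a∈
      (there (here refl))         → b∈
      (there (there (here refl))) → c∈

  Unique-singleton⇒length≡1 : ∀ {xs : List A} {x} → Unique xs → x ∈ xs → (∀ {y} → y ∈ xs → y ≡ x) →
                              length xs ≡ 1
  Unique-singleton⇒length≡1 {xs} {x} xs! x∈ only =
    ≤-antisym (Unique-⊆⇒length≤ {ys = x ∷ []} xs! (λ y∈ → here (only y∈))) (nonempty x∈)
    where
    nonempty : ∀ {x} {ys : List A} → x ∈ ys → 1 ≤ length ys
    nonempty (here _)  = s≤s z≤n
    nonempty (there _) = s≤s z≤n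

module _ {A : Set} where

  length≡0⇒∉ : ∀ {xs : List A} {x} → length xs ≡ 0 → x ∉ xs
  length≡0⇒∉ {[]} _ ()

  ∉⇒length≡0 : ∀ {xs : List A} → (∀ {x} → x ∉ xs) → length xs ≡ 0
  ∉⇒length≡0 {[]}    _   = refl
  ∉⇒length≡0 {x ∷ _} ∉xs = ⊥-elim (∉xs (here refl))

  length≡1⇒singleton : ∀ {xs : List A} → length xs ≡ 1 → ∃ λ x → x ∈ xs × (∀ {y} → y ∈ xs → y ≡ x)
  length≡1⇒singleton {x ∷ []} _ = x , here refl , λ { (here y≡x) → y≡x }

  length≡2⇒pair : ∀ {xs : List A} → length xs ≡ 2 → ∃₂ λ a b → xs ≡ a ∷ b ∷ []
  length≡2⇒pair {a ∷ b ∷ []} _ = a , b , refl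

  pairOf : A → List A → A × A
  pairOf _ (a ∷ b ∷ _) = a , b
  pairOf d _           = d , d

  ∈-pairOf⁺ : ∀ {d xs x} → length xs ≡ 2 → x ≡ proj₁ (pairOf d xs) ⊎ x ≡ proj₂ (pairOf d xs) → x ∈ xs
  ∈-pairOf⁺ {xs = _ ∷ _ ∷ []} _ (inj₁ refl) = here refl
  ∈-pairOf⁺ {xs = _ ∷ _ ∷ []} _ (inj₂ refl) = there (here refl)

  pairOf-distinct : ∀ {d xs} → Unique xs → length xs ≡ 2 → proj₁ (pairOf d xs) ≢ proj₂ (pairOf d xs)
  pairOf-distinct {xs = _ ∷ _ ∷ []} ((a≢b ∷ []) ∷ _) _ = a≢b


  other-of-pair : ∀ {xs : List A} {x} → Unique xs → length xs ≡ 2 → x ∈ xs →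
                  ∃ λ y → y ∈ xs × y ≢ x × (∀ {z} → z ∈ xs → z ≢ x → z ≡ y)
  other-of-pair {a ∷ b ∷ []} ((a≢b ∷ []) ∷ _) _ (here refl) =
    b , there (here refl) , ≢-sym a≢b , λ { (here refl) z≢a → ⊥-elim (z≢a refl) ; (there (here z≡b)) _ → z≡b }
  other-of-pair {a ∷ b ∷ []} ((a≢b ∷ []) ∷ _) _ (there (here refl)) =
    a , here refl , a≢b , λ { (here z≡a) _ → z≡a ; (there (here refl)) z≢b → ⊥-elim (z≢b refl) }

module Degrees (G : Digraph) where
  open Digraph G

  selected : (Fin m → Bool) → List (Fin m)
  selected k = filter (λ e → k e Bool.≟ true) (allFin m)

  inEdges outEdges : (Fin m → Bool) → Fin n → List (Fin m)
  inEdges  k v = filter (λ e → tgt e ≟ v) (selected k)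
  outEdges k v = filter (λ e → src e ≟ v) (selected k)

  Unique-selected : ∀ k → Unique (selected k)
  Unique-selected k = Unique.filter⁺ (λ e → k e Bool.≟ true) (Unique.allFin⁺ m)

  Unique-inEdges : ∀ k v → Unique (inEdges k v)
  Unique-inEdges k v = Unique.filter⁺ (λ e → tgt e ≟ v) (Unique-selected k)

  Unique-outEdges : ∀ k v → Unique (outEdges k v)
  Unique-outEdges k v = Unique.filter⁺ (λ e → src e ≟ v) (Unique-selected k)

  ∈-selected⁺ : ∀ {k e} → k e ≡ true → e ∈ selected k
  ∈-selected⁺ {k} {e} = ∈-filter⁺ (λ e → k e Bool.≟ true) (∈-allFin e)

  ∈-selected⁻ : ∀ {k e} → e ∈ selected k → k e ≡ true
  ∈-selected⁻ {k} = proj₂ ∘ ∈-filter⁻ (λ e → k e Bool.≟ true) {xs = allFin m}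

  ∈-inEdges⁺ : ∀ {k v e} → tgt e ≡ v → k e ≡ true → e ∈ inEdges k v
  ∈-inEdges⁺ {v = v} tgt≡v ke = ∈-filter⁺ (λ e → tgt e ≟ v) (∈-selected⁺ ke) tgt≡v

  ∈-outEdges⁺ : ∀ {k v e} → src e ≡ v → k e ≡ true → e ∈ outEdges k v
  ∈-outEdges⁺ {v = v} src≡v ke = ∈-filter⁺ (λ e → src e ≟ v) (∈-selected⁺ ke) src≡v

  ∈-inEdges⁻ : ∀ {k v e} → e ∈ inEdges k v → tgt e ≡ v × k e ≡ true
  ∈-inEdges⁻ {v = v} e∈ =
    let e∈sel , tgt≡v = ∈-filter⁻ (λ e → tgt e ≟ v) e∈ in tgt≡v , ∈-selected⁻ e∈sel

  ∈-outEdges⁻ : ∀ {k v e} → e ∈ outEdges k v → src e ≡ v × k e ≡ true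
  ∈-outEdges⁻ {v = v} e∈ =
    let e∈sel , src≡v = ∈-filter⁻ (λ e → src e ≟ v) e∈ in src≡v , ∈-selected⁻ e∈sel

  outdeg≡1⇒unique-exit : ∀ {v e f} → outdeg G v ≡ 1 → src e ≡ v → src f ≡ v → e ≡ f
  outdeg≡1⇒unique-exit out≡1 src-e src-f with length≡1⇒singleton out≡1
  ... | _ , _ , only = trans (only (∈-outEdges⁺ src-e refl)) (sym (only (∈-outEdges⁺ src-f refl)))

module Paths (G : Digraph) where
  open Digraph G

  private variable
    K : Fin m → Set
    a b c x : Fin n

  _++ₚ_ : PathIn G K a b → PathIn G K b c → PathIn G K a c
  []            ++ₚ q = q
  (_∷_ e {k} p) ++ₚ q = _∷_ e {k} (p ++ₚ q)

  OnPath-++⁻ : (p : PathIn G K a b) (q : PathIn G K b c) → OnPath G x (p ++ₚ q) → OnPath G x p ⊎ OnPath G x q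
  OnPath-++⁻ []      q on           = inj₂ on
  OnPath-++⁻ (e ∷ p) q (inj₁ x≡src) = inj₁ (inj₁ x≡src)
  OnPath-++⁻ (e ∷ p) q (inj₂ on)    = Sum.map₁ inj₂ (OnPath-++⁻ p q on)

  splitAt : (p : PathIn G K a b) → OnPath G x p → PathIn G K a x × PathIn G K x b
  splitAt []            refl         = [] , []
  splitAt (_∷_ e {k} p) (inj₁ refl)  = [] , _∷_ e {k} p
  splitAt (_∷_ e {k} p) (inj₂ on)    = map₁ (_∷_ e {k}) (splitAt p on)

  forget : PathIn G K a b → Path G a b
  forget []      = []
  forget (e ∷ p) = e ∷ forget p

  edgeCount : PathIn G K a b → ℕ
  edgeCount []      = 0
  edgeCount (_ ∷ p) = suc (edgeCount p)

  vertices : PathIn G K a b → List (Fin n)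
  vertices {a = a} [] = a ∷ []
  vertices (e ∷ p)    = src e ∷ vertices p

  length-vertices : (p : PathIn G K a b) → length (vertices p) ≡ suc (edgeCount p)
  length-vertices []      = refl
  length-vertices (e ∷ p) = cong suc (length-vertices p)

  prefix : (p : PathIn G K a b) → x ∈ vertices p → PathIn G K a x
  prefix []            (here refl)  = []
  prefix (e ∷ p)       (here refl)  = []
  prefix (_∷_ e {k} p) (there x∈)   = _∷_ e {k} (prefix p x∈)

  module _ (acyclic : Acyclic G) where

    Unique-vertices : (p : PathIn G K a b) → Unique (vertices p)
    Unique-vertices []      = [] ∷ []
    Unique-vertices (e ∷ p) =
      All.tabulate (λ { y∈ refl → acyclic _ e refl (forget (prefix p y∈)) }) ∷ Unique-vertices p

    edgeCount<n : (p : PathIn G K a b) → edgeCount p < n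
    edgeCount<n p = subst₂ _≤_ (length-vertices p) (length-tabulate id)
      (Unique-⊆⇒length≤ _≟_ (Unique-vertices p) (λ {x} _ → ∈-allFin x))

    -- Walking back along parent edges must reach r within n steps, as longer paths would repeat a vertex.
    module _ {r : Fin n} (parent : ∀ v → v ≢ r → ∃ λ e → tgt e ≡ v × K e) where

      private
        walk : ∀ k v → PathIn G K r v ⊎ ∃₂ λ w (p : PathIn G K w v) → edgeCount p ≡ k
        walk zero    v = inj₂ (v , [] , refl)
        walk (suc k) v with walk k v
        ... | inj₁ p = inj₁ p
        ... | inj₂ (w , p , count) with w ≟ r
        ...   | yes refl = inj₁ p
        ...   | no w≢r with parent w w≢r
        ...     | e , refl , ke = inj₂ (src e , _∷_ e {ke} p , cong suc count)

      reachable-via-parents : ∀ v → PathIn G K r v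
      reachable-via-parents v with walk n v
      ... | inj₁ p = p
      ... | inj₂ (_ , p , count) = ⊥-elim (<-irrefl count (edgeCount<n p))

-- An item (l , a , b) offers two slots a, b for the label l. For a network, labels are the
-- reticulations, slots their entering branches and src gives the parent. Labels outside the list
-- are mapped to the junk value inhabitant.
module DistinctSourceChoice
  {L E V : Set} (_≟L_ : DecidableEquality L) (_≟V_ : DecidableEquality V)
  (src : E → V)
  (at-most-two : ∀ {a b c} → a ≢ b → a ≢ c → b ≢ c → src a ≡ src b → src a ≡ src c → ⊥)
  (inhabitant : E)
  where

  Item : Set
  Item = L × E × E

  lab : Item → L
  lab = proj₁

  Slot : Item → E → Set
  Slot (_ , a , b) x = x ≡ a ⊎ x ≡ b

  record Admissible (es : List Item) : Set where
    field
      lab-injective  : ∀ {p q} → p ∈ es → q ∈ es → lab p ≡ lab q → p ≡ q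
      slots-distinct : ∀ {l a b} → (l , a , b) ∈ es → a ≢ b
      slots-disjoint : ∀ {p q x} → p ∈ es → q ∈ es → lab p ≢ lab q → Slot p x → Slot q x → ⊥

    slots-apart : ∀ {p q x y} → p ∈ es → q ∈ es → lab p ≢ lab q → Slot p x → Slot q y → x ≢ y
    slots-apart p∈ q∈ lp≢lq sx sy refl = slots-disjoint p∈ q∈ lp≢lq sx sy

  Admissible-⊆ : ∀ {es es′} → es ⊆ es′ → Admissible es′ → Admissible es
  Admissible-⊆ es⊆ adm = record
    { lab-injective  = λ p∈ q∈ → lab-injective (es⊆ p∈) (es⊆ q∈)
    ; slots-distinct = λ p∈ → slots-distinct (es⊆ p∈)
    ; slots-disjoint = λ p∈ q∈ → slots-disjoint (es⊆ p∈) (es⊆ q∈)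
    }
    where open Admissible adm

  record IsChoice (es : List Item) (c : L → E) : Set where
    field
      chosen-slot   : ∀ {p} → p ∈ es → Slot p (c (lab p))
      src-injective : ∀ {p q} → p ∈ es → q ∈ es → src (c (lab p)) ≡ src (c (lab q)) → lab p ≡ lab q

  IsChoice-⊆ : ∀ {es es′ c} → es ⊆ es′ → IsChoice es′ c → IsChoice es c
  IsChoice-⊆ es⊆ C = record
    { chosen-slot   = λ p∈ → chosen-slot (es⊆ p∈)
    ; src-injective = λ p∈ q∈ → src-injective (es⊆ p∈) (es⊆ q∈)
    }
    where open IsChoice C

  Choice : List Item → Set
  Choice es = Σ (L → E) (IsChoice es)

  _[_≔_] : (L → E) → L → E → L → E
  (c [ l ≔ x ]) l′ = if does (l′ ≟L l) then x else c l′

  [≔]-same : ∀ c l x → (c [ l ≔ x ]) l ≡ x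
  [≔]-same c l x with l ≟L l
  ... | yes _  = refl
  ... | no l≢l = ⊥-elim (l≢l refl)

  [≔]-other : ∀ c {l l′} x → l′ ≢ l → (c [ l ≔ x ]) l′ ≡ c l′
  [≔]-other c {l} {l′} x l′≢l with l′ ≟L l
  ... | yes l′≡l = ⊥-elim (l′≢l l′≡l)
  ... | no _     = refl

  IsChoice-∷ : ∀ {es c p x} → IsChoice es c →
               (∀ {q} → q ∈ es → lab q ≢ lab p) → Slot p x →
               (∀ {q} → q ∈ es → src (c (lab q)) ≢ src x) →
               IsChoice (p ∷ es) (c [ lab p ≔ x ])
  IsChoice-∷ {es} {c} {p} {x} C fresh sx apart = record
    { chosen-slot   = chosen-slot′
    ; src-injective = src-injective′
    }
    where
    open IsChoice C
    c′ : L → E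
    c′ = c [ lab p ≔ x ]
    same : c′ (lab p) ≡ x
    same = [≔]-same c (lab p) x
    other : ∀ {q} → q ∈ es → c′ (lab q) ≡ c (lab q)
    other q∈ = [≔]-other c x (fresh q∈)
    apart′ : ∀ {q} → q ∈ es → src (c′ (lab q)) ≢ src (c′ (lab p))
    apart′ q∈ e = apart q∈ (trans (cong src (sym (other q∈))) (trans e (cong src same)))
    chosen-slot′ : ∀ {q} → q ∈ p ∷ es → Slot q (c′ (lab q))
    chosen-slot′ (here refl) = subst (Slot p) (sym same) sx
    chosen-slot′ {q} (there q∈) = subst (Slot q) (sym (other q∈)) (chosen-slot q∈)
    src-injective′ : ∀ {q q′} → q ∈ p ∷ es → q′ ∈ p ∷ es →
                     src (c′ (lab q)) ≡ src (c′ (lab q′)) → lab q ≡ lab q′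
    src-injective′ (here refl) (here refl) _ = refl
    src-injective′ (here refl) (there q∈) e = ⊥-elim (apart′ q∈ (sym e))
    src-injective′ (there q∈) (here refl) e = ⊥-elim (apart′ q∈ e)
    src-injective′ (there q∈) (there q′∈) e =
      src-injective q∈ q′∈ (trans (cong src (sym (other q∈))) (trans e (cong src (other q′∈))))

  IsChoice-∷∷ : ∀ {es c p q x y} → IsChoice es c → lab q ≢ lab p →
                (∀ {r} → r ∈ es → lab r ≢ lab p) → (∀ {r} → r ∈ es → lab r ≢ lab q) →
                Slot p x → Slot q y → src y ≢ src x →
                (∀ {r} → r ∈ es → src (c (lab r)) ≢ src x) →
                (∀ {r} → r ∈ es → src (c (lab r)) ≢ src y) →
                IsChoice (p ∷ q ∷ es) ((c [ lab q ≔ y ]) [ lab p ≔ x ])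
  IsChoice-∷∷ {c = c} {q = q} {y = y} C lq≢lp fresh-p fresh-q sx sy src-y≢src-x apart-x apart-y =
    IsChoice-∷ (IsChoice-∷ C fresh-q sy apart-y) fresh-p′ sx apart-x′
    where
    fresh-p′ : ∀ {r} → r ∈ q ∷ _ → lab r ≢ _
    fresh-p′ (here refl) = lq≢lp
    fresh-p′ (there r∈) = fresh-p r∈
    apart-x′ : ∀ {r} → r ∈ q ∷ _ → src ((c [ lab q ≔ y ]) (lab r)) ≢ _
    apart-x′ (here refl) e = src-y≢src-x (trans (cong src (sym ([≔]-same c (lab q) y))) e)
    apart-x′ (there r∈) e = apart-x r∈ (trans (cong src (sym ([≔]-other c y (fresh-q r∈)))) e)

  dropLabel : L → List Item → List Item
  dropLabel l = filter (λ q → ¬? (lab q ≟L l))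

  ∈-dropLabel⁻ : ∀ {l q} es → q ∈ dropLabel l es → q ∈ es × lab q ≢ l
  ∈-dropLabel⁻ {l} es = ∈-filter⁻ (λ q → ¬? (lab q ≟L l)) {xs = es}

  ⊆-∷-dropLabel : ∀ {p es} → (∀ {q} → q ∈ es → lab q ≡ lab p → q ≡ p) →
                  p ∷ es ⊆ p ∷ dropLabel (lab p) es
  ⊆-∷-dropLabel same-lab (here refl) = here refl
  ⊆-∷-dropLabel {p} same-lab {q} (there q∈) with lab q ≟L lab p
  ... | yes lq≡lp = here (same-lab q∈ lq≡lp)
  ... | no lq≢lp  = there (∈-filter⁺ (λ r → ¬? (lab r ≟L lab p)) q∈ lq≢lp)

  length-dropLabel< : ∀ {p es} → p ∈ es → length (dropLabel (lab p) es) < length es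
  length-dropLabel< {es = es} p∈ =
    filter-notAll (λ q → ¬? (lab q ≟L _)) es (Any.map (λ { refl lp≢lp → lp≢lp refl }) p∈)

  Occurs : V → Item → Set
  Occurs u (_ , a , b) = src a ≡ u ⊎ src b ≡ u

  occurs? : ∀ u p → Dec (Occurs u p)
  occurs? u (_ , a , b) = (src a ≟V u) ⊎-dec (src b ≟V u)

  occurs-slot : ∀ {u x} p → Slot p x → src x ≡ u → Occurs u p
  occurs-slot _ (inj₁ refl) e = inj₁ e
  occurs-slot _ (inj₂ refl) e = inj₂ e

  record SlotsFrom (u : V) (p : Item) : Set where
    field
      at other   : E
      at-slot    : Slot p at
      other-slot : Slot p other
      at≢other   : at ≢ other
      src-at     : src at ≡ u

  slotsFrom : ∀ {u} p → proj₁ (proj₂ p) ≢ proj₂ (proj₂ p) → Occurs u p → SlotsFrom u p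
  slotsFrom _ a≢b (inj₁ e) =
    record { at-slot = inj₁ refl ; other-slot = inj₂ refl ; at≢other = a≢b ; src-at = e }
  slotsFrom _ a≢b (inj₂ e) =
    record { at-slot = inj₂ refl ; other-slot = inj₁ refl ; at≢other = ≢-sym a≢b ; src-at = e }

  -- The slot a₀ of e₀ and the slot a₁ of p₁ share the source u, which no other slot has. A choice in
  -- which e₀ and p₁ are merged into (l₀ , b₀ , b₁) lifts back: whichever of b₀, b₁ it picks goes to
  -- its own item, and the other item takes its slot at u.
  module Merge {l₀ a₀ b₀ rest} (adm : Admissible ((l₀ , a₀ , b₀) ∷ rest))
               (fresh : ∀ {q} → q ∈ rest → lab q ≢ l₀)
               {p₁} (p₁∈ : p₁ ∈ rest) (occ : Occurs (src a₀) p₁) where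

    open Admissible adm
    private
      u : V
      u = src a₀
      e₀ : Item
      e₀ = (l₀ , a₀ , b₀)
      l₁ : L
      l₁ = lab p₁
      e₀∈ : e₀ ∈ e₀ ∷ rest
      e₀∈ = here refl
      p₁∈′ : p₁ ∈ e₀ ∷ rest
      p₁∈′ = there p₁∈
      l₁≢l₀ : l₁ ≢ l₀
      l₁≢l₀ = fresh p₁∈
      l₀≢l₁ : l₀ ≢ l₁
      l₀≢l₁ = ≢-sym l₁≢l₀

    open SlotsFrom (slotsFrom p₁ (slots-distinct p₁∈′) occ)
      renaming (at to a₁; other to b₁; at-slot to a₁-slot; other-slot to b₁-slot)

    mid : List Item
    mid = dropLabel l₁ rest

    merged : Item
    merged = (l₀ , b₀ , b₁)

    private
      mid⊆rest : ∀ {q} → q ∈ mid → q ∈ e₀ ∷ rest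
      mid⊆rest q∈ = there (proj₁ (∈-dropLabel⁻ rest q∈))
      mid≢l₀ : ∀ {q} → q ∈ mid → lab q ≢ l₀
      mid≢l₀ q∈ = fresh (proj₁ (∈-dropLabel⁻ rest q∈))
      mid≢l₁ : ∀ {q} → q ∈ mid → lab q ≢ l₁
      mid≢l₁ q∈ = proj₂ (∈-dropLabel⁻ rest q∈)

      a₀≢a₁ : a₀ ≢ a₁
      a₀≢a₁ = slots-apart e₀∈ p₁∈′ l₀≢l₁ (inj₁ refl) a₁-slot

      src≢u : ∀ {x} → x ≢ a₀ → x ≢ a₁ → src x ≢ u
      src≢u x≢a₀ x≢a₁ srcx≡u = at-most-two a₀≢a₁ (≢-sym x≢a₀) (≢-sym x≢a₁) (sym src-at) (sym srcx≡u)

      src-b₀≢u : src b₀ ≢ u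
      src-b₀≢u = src≢u (≢-sym (slots-distinct e₀∈)) (slots-apart e₀∈ p₁∈′ l₀≢l₁ (inj₂ refl) a₁-slot)

      src-b₁≢u : src b₁ ≢ u
      src-b₁≢u = src≢u (slots-apart p₁∈′ e₀∈ l₁≢l₀ b₁-slot (inj₁ refl)) (≢-sym at≢other)

      src-mid≢u : ∀ {q x} → q ∈ mid → Slot q x → src x ≢ u
      src-mid≢u q∈ sx = src≢u (slots-apart (mid⊆rest q∈) e₀∈ (mid≢l₀ q∈) sx (inj₁ refl))
                              (slots-apart (mid⊆rest q∈) p₁∈′ (mid≢l₁ q∈) sx a₁-slot)

      merged-slot : ∀ {x} → Slot merged x → Slot e₀ x ⊎ Slot p₁ x
      merged-slot (inj₁ x≡b₀) = inj₁ (inj₂ x≡b₀)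
      merged-slot (inj₂ refl) = inj₂ b₁-slot

      merged-disjoint : ∀ {q x} → q ∈ mid → Slot merged x → Slot q x → ⊥
      merged-disjoint q∈ sx sy with merged-slot sx
      ... | inj₁ s = slots-disjoint e₀∈ (mid⊆rest q∈) (≢-sym (mid≢l₀ q∈)) s sy
      ... | inj₂ s = slots-disjoint p₁∈′ (mid⊆rest q∈) (≢-sym (mid≢l₁ q∈)) s sy

    length-merged : length (merged ∷ mid) ≤ length rest
    length-merged = length-dropLabel< p₁∈

    admissible-merged : Admissible (merged ∷ mid)
    admissible-merged = record
      { lab-injective  = lab-injective′
      ; slots-distinct = slots-distinct′
      ; slots-disjoint = slots-disjoint′
      }
      where
      lab-injective′ : ∀ {p q} → p ∈ merged ∷ mid → q ∈ merged ∷ mid → lab p ≡ lab q → p ≡ q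
      lab-injective′ (here refl) (here refl) _  = refl
      lab-injective′ (here refl) (there q∈) e  = ⊥-elim (mid≢l₀ q∈ (sym e))
      lab-injective′ (there p∈) (here refl) e  = ⊥-elim (mid≢l₀ p∈ e)
      lab-injective′ (there p∈) (there q∈) e = lab-injective (mid⊆rest p∈) (mid⊆rest q∈) e
      slots-distinct′ : ∀ {l a b} → (l , a , b) ∈ merged ∷ mid → a ≢ b
      slots-distinct′ (here refl) = slots-apart e₀∈ p₁∈′ l₀≢l₁ (inj₂ refl) b₁-slot
      slots-distinct′ (there q∈) = slots-distinct (mid⊆rest q∈)
      slots-disjoint′ : ∀ {p q x} → p ∈ merged ∷ mid → q ∈ merged ∷ mid → lab p ≢ lab q →
                        Slot p x → Slot q x → ⊥
      slots-disjoint′ (here refl) (here refl) l≢l _ _ = l≢l refl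
      slots-disjoint′ (here refl) (there q∈) _ sx sy = merged-disjoint q∈ sx sy
      slots-disjoint′ (there p∈) (here refl) _ sx sy = merged-disjoint p∈ sy sx
      slots-disjoint′ (there p∈) (there q∈) = slots-disjoint (mid⊆rest p∈) (mid⊆rest q∈)

    unmerge : Choice (merged ∷ mid) → Choice (e₀ ∷ rest)
    unmerge (c , C) = map₂ (IsChoice-⊆ split) (restore (chosen-slot (here refl)))
      where
      open IsChoice C
      C-mid : IsChoice mid c
      C-mid = IsChoice-⊆ there C
      apart-c₀ : ∀ {q} → q ∈ mid → src (c (lab q)) ≢ src (c l₀)
      apart-c₀ q∈ e = mid≢l₀ q∈ (src-injective (there q∈) (here refl) e)
      apart-u : ∀ {q} → q ∈ mid → src (c (lab q)) ≢ u
      apart-u q∈ = src-mid≢u q∈ (chosen-slot (there q∈))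
      restore : c l₀ ≡ b₀ ⊎ c l₀ ≡ b₁ → Choice (e₀ ∷ p₁ ∷ mid)
      restore (inj₁ c₀≡b₀) = _ , IsChoice-∷∷ C-mid l₁≢l₀ mid≢l₀ mid≢l₁ (inj₂ refl) a₁-slot
        (λ e → src-b₀≢u (trans (sym e) src-at))
        (λ q∈ e → apart-c₀ q∈ (trans e (cong src (sym c₀≡b₀))))
        (λ q∈ e → apart-u q∈ (trans e src-at))
      restore (inj₂ c₀≡b₁) = _ , IsChoice-∷∷ C-mid l₁≢l₀ mid≢l₀ mid≢l₁ (inj₁ refl) b₁-slot
        src-b₁≢u
        apart-u
        (λ q∈ e → apart-c₀ q∈ (trans e (cong src (sym c₀≡b₁))))
      split : e₀ ∷ rest ⊆ e₀ ∷ p₁ ∷ mid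
      split = ∷⁺ʳ e₀ (λ q∈ → ⊆-∷-dropLabel (λ q∈ e → lab-injective (there q∈) p₁∈′ e) (there q∈))

  mutual
    choose : ∀ k es → length es ≤ k → Admissible es → Choice es
    choose _ [] _ _ = (λ _ → inhabitant) , record { chosen-slot = λ () ; src-injective = λ () }
    choose (suc k) (e₀ ∷ rest) (s≤s len) adm =
      map₂ (IsChoice-⊆ (⊆-∷-dropLabel (λ q∈ → lab-injective (there q∈) (here refl))))
        (chooseFresh k e₀ (dropLabel (lab e₀) rest) (≤-trans (length-filter _ rest) len)
          (Admissible-⊆ (∷⁺ʳ e₀ (λ q∈ → proj₁ (∈-dropLabel⁻ rest q∈))) adm)
          (λ q∈ → proj₂ (∈-dropLabel⁻ rest q∈)))
      where open Admissible adm

    chooseFresh : ∀ k e₀ rest → length rest ≤ k → Admissible (e₀ ∷ rest) →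
                  (∀ {q} → q ∈ rest → lab q ≢ lab e₀) → Choice (e₀ ∷ rest)
    chooseFresh k e₀@(l₀ , a₀ , _) rest len adm fresh with any? (occurs? (src a₀)) rest
    ... | no unoccupied =
      let c , C = choose k rest len (Admissible-⊆ (xs⊆x∷xs rest e₀) adm)
      in c [ l₀ ≔ a₀ ] , IsChoice-∷ C fresh (inj₁ refl)
           (λ {q} q∈ e → unoccupied (lose q∈ (occurs-slot q (IsChoice.chosen-slot C q∈) e)))
    ... | yes occupied =
      let p₁ , p₁∈ , occ = find occupied
          open Merge adm fresh p₁∈ occ
      in unmerge (choose k (merged ∷ mid) (≤-trans length-merged len) admissible-merged)

  choice : ∀ es → Admissible es → Choice es
  choice es = choose (length es) es ≤-refl

degree-split : ∀ i o → i + o ≡ 3 → i ≢ 0 → o ≢ 0 → (i ≡ 1 × o ≡ 2) ⊎ (i ≡ 2 × o ≡ 1)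
degree-split zero    _    _  i≢0 _   = ⊥-elim (i≢0 refl)
degree-split (suc _) zero _  _   o≢0 = ⊥-elim (o≢0 refl)
degree-split 1 1 ()
degree-split 1 2 _ _ _ = inj₁ (refl , refl)
degree-split 1 (suc (suc (suc _))) ()
degree-split 2 1 _ _ _ = inj₂ (refl , refl)
degree-split 2 (suc (suc _)) ()
degree-split 3 (suc _) ()
degree-split (suc (suc (suc (suc _)))) _ ()

module BinaryNetwork (N : Network) (binary : Binary N) where
  open Network N
  open Degrees G public
  open Paths G public

  private
    outdeg-root : outdeg G root ≡ 2
    outdeg-root = proj₁ binary

  inE outE : Fin n → List (Fin m)
  inE  = inEdges (allE G)
  outE = outEdges (allE G)

  isReticulation? : ∀ v → Dec (IsReticulation G v)
  isReticulation? v = (2 ≤? indeg G v) ×-dec (outdeg G v ℕ.≟ 1)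

  reticulation≢root : ∀ {r} → IsReticulation G r → r ≢ root
  reticulation≢root (_ , out≡1) refl with trans (sym out≡1) outdeg-root
  ... | ()

  inner-degrees : ∀ v → v ≢ root → ¬ IsLeaf G v →
                  (indeg G v ≡ 1 × outdeg G v ≡ 2) ⊎ (indeg G v ≡ 2 × outdeg G v ≡ 1)
  inner-degrees v v≢root nonleaf =
    degree-split _ _ (proj₂ (proj₂ binary) v v≢root nonleaf) (v≢root ∘ unique-root v) nonleaf

  indeg-reticulation : ∀ {r} → IsReticulation G r → indeg G r ≡ 2
  indeg-reticulation {r} ret@(_ , out≡1) with inner-degrees r (reticulation≢root ret) (1+n≢0 ∘ trans (sym out≡1))
  ... | inj₁ (_ , out≡2) with trans (sym out≡1) out≡2
  ...   | ()
  indeg-reticulation ret | inj₂ (in≡2 , _) = in≡2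

  indeg-nonreticulation : ∀ {v} → v ≢ root → ¬ IsReticulation G v → indeg G v ≡ 1
  indeg-nonreticulation {v} v≢root nonret with outdeg G v ℕ.≟ 0
  ... | yes leaf = proj₁ (proj₂ binary) v leaf
  ... | no nonleaf with inner-degrees v v≢root nonleaf
  ...   | inj₁ (in≡1 , _) = in≡1
  ...   | inj₂ (in≡2 , out≡1) = ⊥-elim (nonret (≤-reflexive (sym in≡2) , out≡1))

  outdeg-nonreticulation : ∀ {v} → ¬ IsReticulation G v → ¬ IsLeaf G v → outdeg G v ≡ 2
  outdeg-nonreticulation {v} nonret nonleaf with v ≟ root
  ... | yes refl = outdeg-root
  ... | no v≢root with inner-degrees v v≢root nonleaf
  ...   | inj₁ (_ , out≡2) = out≡2
  ...   | inj₂ (in≡2 , out≡1) = ⊥-elim (nonret (≤-reflexive (sym in≡2) , out≡1))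

  outdeg≤2 : ∀ v → outdeg G v ≤ 2
  outdeg≤2 v with isReticulation? v | outdeg G v ℕ.≟ 0
  ... | yes (_ , out≡1) | _        = ≤-trans (≤-reflexive out≡1) (s≤s z≤n)
  ... | no _            | yes leaf = ≤-trans (≤-reflexive leaf) z≤n
  ... | no nonret       | no nonleaf = ≤-reflexive (outdeg-nonreticulation nonret nonleaf)

  at-most-two-siblings : ∀ {a b c} → a ≢ b → a ≢ c → b ≢ c → src a ≡ src b → src a ≡ src c → ⊥
  at-most-two-siblings a≢b a≢c b≢c src-b src-c =
    <-irrefl refl (≤-trans (three-distinct⇒3≤length _≟_ a≢b a≢c b≢c
      (∈-outEdges⁺ refl refl) (∈-outEdges⁺ (sym src-b) refl) (∈-outEdges⁺ (sym src-c) refl)) (outdeg≤2 _))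

  module _ (visible : ReticulationVisible N) where

    -- Let c be the child of r, p its other parent and l a leaf for which r is stable. Then r lies on
    -- root ⇝ p → c ⇝ l but not on c ⇝ l, so r ⇝ p; every path leaving r starts with r → c, which
    -- closes the cycle c ⇝ p → c.
    reticulation-child-not-reticulation : ∀ {r e} → IsReticulation G r → src e ≡ r → ¬ IsReticulation G (tgt e)
    reticulation-child-not-reticulation {r} {e} ret@(_ , out≡1) src-e≡r child-ret
      with visible r ret
         | other-of-pair (Unique-inEdges (allE G) (tgt e)) (indeg-reticulation child-ret) (∈-inEdges⁺ refl refl)
    ... | l , leaf , stable | e′ , e′∈ , e′≢e , _ = acyclic (src e′) e′ refl c⇝p
      where
      leave-r : ∀ {w} → Path G r w → r ≢ w → Path G (tgt e) w
      leave-r (f ∷ q) _ = subst (λ v → Path G (tgt v) _) (outdeg≡1⇒unique-exit out≡1 refl src-e≡r) q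
      leave-r [] r≢r = ⊥-elim (r≢r refl)

      tgt-e′ : tgt e′ ≡ tgt e
      tgt-e′ = proj₁ (∈-inEdges⁻ e′∈)

      c⇝l : Path G (tgt e′) l
      c⇝l = subst (λ v → Path G v l) (sym tgt-e′)
              (leave-r (proj₂ (splitAt (reachable l) (stable (reachable l))))
                       (λ r≡l → 1+n≢0 (trans (sym out≡1) (trans (cong (outdeg G) r≡l) leaf))))

      r≢p : r ≢ src e′
      r≢p r≡p = e′≢e (simple e′ e (trans (sym r≡p) (sym src-e≡r)) tgt-e′)

      r⇝p : Path G r (src e′)
      r⇝p with OnPath-++⁻ (reachable (src e′)) (e′ ∷ c⇝l) (stable (reachable (src e′) ++ₚ (e′ ∷ c⇝l)))
      ... | inj₁ on-root⇝p = proj₂ (splitAt (reachable (src e′)) on-root⇝p)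
      ... | inj₂ (inj₁ r≡p) = ⊥-elim (r≢p r≡p)
      ... | inj₂ (inj₂ on-c⇝l) = ⊥-elim (acyclic r e src-e≡r (subst (λ v → Path G v r) tgt-e′ (proj₁ (splitAt c⇝l on-c⇝l))))

      c⇝p : Path G (tgt e′) (src e′)
      c⇝p = subst (λ v → Path G v (src e′)) (sym tgt-e′) (leave-r r⇝p r≢p)

module Construction (N : Network) (binary : Binary N) (visible : ReticulationVisible N) where
  open Network N
  open BinaryNetwork N binary

  -- Junk default for pairOf and for labels outside the choice; any branch would do.
  anEdge : Fin m
  anEdge = proj₁ (length≡2⇒pair {xs = outE root} (proj₁ binary))

  open DistinctSourceChoice {L = Fin n} _≟_ _≟_ src at-most-two-siblings anEdge

  item : Fin n → Item
  item r = r , pairOf anEdge (inE r)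

  items : List Item
  items = map item (filter isReticulation? (allFin n))

  item∈items : ∀ {r} → IsReticulation G r → item r ∈ items
  item∈items {r} ret = ∈-map⁺ item (∈-filter⁺ isReticulation? (∈-allFin r) ret)

  ReticulationItem : Item → Set
  ReticulationItem p = ∃ λ r → IsReticulation G r × p ≡ item r

  ∈-items⁻ : ∀ {p} → p ∈ items → ReticulationItem p
  ∈-items⁻ p∈ with ∈-map⁻ item p∈
  ... | r , r∈ , refl = r , proj₂ (∈-filter⁻ isReticulation? {xs = allFin n} r∈) , refl

  Slot-item⇒tgt : ∀ {r x} → IsReticulation G r → Slot (item r) x → tgt x ≡ r
  Slot-item⇒tgt ret sx = proj₁ (∈-inEdges⁻ (∈-pairOf⁺ (indeg-reticulation ret) sx))

  admissible-items : Admissible items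
  admissible-items = record
    { lab-injective  = λ p∈ q∈ → lab-injective (∈-items⁻ p∈) (∈-items⁻ q∈)
    ; slots-distinct = λ p∈ → slots-distinct (∈-items⁻ p∈)
    ; slots-disjoint = λ p∈ q∈ → slots-disjoint (∈-items⁻ p∈) (∈-items⁻ q∈)
    }
    where
    lab-injective : ∀ {p q} → ReticulationItem p → ReticulationItem q → lab p ≡ lab q → p ≡ q
    lab-injective (_ , _ , refl) (_ , _ , refl) refl = refl
    slots-distinct : ∀ {l a b} → ReticulationItem (l , a , b) → a ≢ b
    slots-distinct (r , ret , refl) = pairOf-distinct (Unique-inEdges (allE G) r) (indeg-reticulation ret)
    slots-disjoint : ∀ {p q x} → ReticulationItem p → ReticulationItem q → lab p ≢ lab q → Slot p x → Slot q x → ⊥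
    slots-disjoint (_ , ret , refl) (_ , ret′ , refl) r≢r′ sx sx′ =
      r≢r′ (trans (sym (Slot-item⇒tgt ret sx)) (Slot-item⇒tgt ret′ sx′))

  chosen : Choice items
  chosen = choice items admissible-items

  ch : Fin n → Fin m
  ch = proj₁ chosen

  ch-enters : ∀ {r} → IsReticulation G r → tgt (ch r) ≡ r
  ch-enters ret = Slot-item⇒tgt ret (IsChoice.chosen-slot (proj₂ chosen) (item∈items ret))

  ch-src-injective : ∀ {r r′} → IsReticulation G r → IsReticulation G r′ →
                     src (ch r) ≡ src (ch r′) → r ≡ r′
  ch-src-injective ret ret′ = IsChoice.src-injective (proj₂ chosen) (item∈items ret) (item∈items ret′)

  deleted? : ∀ e → Dec (IsReticulation G (tgt e) × e ≡ ch (tgt e))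
  deleted? e = isReticulation? (tgt e) ×-dec (e ≟ ch (tgt e))

  del : Fin m → Bool
  del e = does (deleted? e)

  deleted⇒ : ∀ {e} → del e ≡ true → IsReticulation G (tgt e) × e ≡ ch (tgt e)
  deleted⇒ {e} = does≡true⇒ (deleted? e)

  ch-deleted : ∀ {r} → IsReticulation G r → del (ch r) ≡ true
  ch-deleted {r} ret =
    dec-true (deleted? (ch r)) (subst (IsReticulation G) (sym (ch-enters ret)) ret , cong ch (sym (ch-enters ret)))

  nonreticulation-kept : ∀ {e} → ¬ IsReticulation G (tgt e) → del e ≡ false
  nonreticulation-kept {e} nonret = dec-false (deleted? e) (nonret ∘ proj₁)

  unchosen-kept : ∀ {e} → e ≢ ch (tgt e) → del e ≡ false
  unchosen-kept {e} e≢ch = dec-false (deleted? e) (e≢ch ∘ proj₂)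

  deleted-src-injective : ∀ {e f} → del e ≡ true → del f ≡ true → src e ≡ src f → e ≡ f
  deleted-src-injective {e} {f} del-e del-f src-e≡src-f = simple e f src-e≡src-f tgt-e≡tgt-f
    where
    tgt-e≡tgt-f : tgt e ≡ tgt f
    tgt-e≡tgt-f with deleted⇒ del-e | deleted⇒ del-f
    ... | ret , e≡ch | ret′ , f≡ch =
      ch-src-injective ret ret′ (trans (cong src (sym e≡ch)) (trans src-e≡src-f (cong src f≡ch)))

  valid-choice : ValidChoice N del
  valid-choice = (λ _ → proj₁ ∘ deleted⇒)
               , λ r ret → ch r , ch-enters ret , ch-deleted ret
                         , λ f tgt-f≡r del-f → trans (proj₂ (deleted⇒ del-f)) (cong ch tgt-f≡r)

  kept-parent : ∀ v → v ≢ root →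
                ∃ λ e → tgt e ≡ v × del e ≡ false × (∀ {f} → tgt f ≡ v → del f ≡ false → f ≡ e)
  kept-parent v v≢root with isReticulation? v
  ... | yes ret =
    let e , e∈ , e≢ch , only = other-of-pair (Unique-inEdges (allE G) v) (indeg-reticulation ret)
                                             (∈-inEdges⁺ (ch-enters ret) refl)
        tgt-e≡v = proj₁ (∈-inEdges⁻ e∈)
    in e , tgt-e≡v , unchosen-kept (λ e≡ch → e≢ch (trans e≡ch (cong ch tgt-e≡v)))
         , λ {f} tgt-f≡v del-f → only (∈-inEdges⁺ tgt-f≡v refl)
             (λ { refl → not-¬ (ch-deleted ret) del-f })
  ... | no nonret =
    let e , e∈ , only = length≡1⇒singleton (indeg-nonreticulation v≢root nonret)
        tgt-e≡v = proj₁ (∈-inEdges⁻ e∈)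
    in e , tgt-e≡v , nonreticulation-kept (nonret ∘ subst (IsReticulation G) tgt-e≡v)
         , λ tgt-f≡v _ → only (∈-inEdges⁺ tgt-f≡v refl)

  kept⁺ : ∀ {e} → del e ≡ false → keep N del e ≡ true
  kept⁺ = cong not

  kept⁻ : ∀ {e} → keep N del e ≡ true → del e ≡ false
  kept⁻ = not-injective

  spanning-tree : SpanningTree N del
  spanning-tree = root-orphan , unique-parent , reachable-via-parents acyclic kept-edge
    where
    root-orphan : indegIn G (keep N del) root ≡ 0
    root-orphan = ∉⇒length≡0 λ e∈ → length≡0⇒∉ root-indeg (∈-inEdges⁺ (proj₁ (∈-inEdges⁻ e∈)) refl)
    unique-parent : ∀ v → v ≢ root → indegIn G (keep N del) v ≡ 1
    unique-parent v v≢root =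
      let e , tgt-e≡v , del-e , only = kept-parent v v≢root
      in Unique-singleton⇒length≡1 _≟_ (Unique-inEdges _ v) (∈-inEdges⁺ tgt-e≡v (kept⁺ del-e))
           λ f∈ → let tgt-f≡v , keep-f = ∈-inEdges⁻ f∈ in only tgt-f≡v (kept⁻ keep-f)
    kept-edge : ∀ v → v ≢ root → ∃ λ e → tgt e ≡ v × Kept N del e
    kept-edge v v≢root = let e , tgt-e≡v , del-e , _ = kept-parent v v≢root in e , tgt-e≡v , del-e

  kept-child : ∀ v → ¬ IsLeaf G v → ∃ λ e → src e ≡ v × del e ≡ false
  kept-child v nonleaf with isReticulation? v
  ... | yes ret =
    let e , e∈ , _ = length≡1⇒singleton (proj₂ ret)
        src-e≡v = proj₁ (∈-outEdges⁻ e∈)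
    in e , src-e≡v , nonreticulation-kept (reticulation-child-not-reticulation visible ret src-e≡v)
  ... | no nonret = some-kept (leaves-v (inj₁ refl)) (leaves-v (inj₂ refl))
                               (pairOf-distinct {d = anEdge} (Unique-outEdges (allE G) v) out≡2)
    where
    out≡2 : outdeg G v ≡ 2
    out≡2 = outdeg-nonreticulation nonret nonleaf
    leaves-v : ∀ {x} → x ≡ proj₁ (pairOf anEdge (outE v)) ⊎ x ≡ proj₂ (pairOf anEdge (outE v)) → src x ≡ v
    leaves-v sx = proj₁ (∈-outEdges⁻ (∈-pairOf⁺ out≡2 sx))
    some-kept : ∀ {a b} → src a ≡ v → src b ≡ v → a ≢ b → ∃ λ e → src e ≡ v × del e ≡ false
    some-kept {a} {b} src-a src-b a≢b with del a in del-a | del b in del-b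
    ... | false | _     = a , src-a , del-a
    ... | true  | false = b , src-b , del-b
    ... | true  | true  = ⊥-elim (a≢b (deleted-src-injective del-a del-b (trans src-a (sym src-b))))

  no-dummy-leaves : NoDummyLeaves N del
  no-dummy-leaves v out≡0 with outdeg G v ℕ.≟ 0
  ... | yes leaf = leaf
  ... | no nonleaf =
    let e , src-e≡v , del-e = kept-child v nonleaf
    in ⊥-elim (length≡0⇒∉ out≡0 (∈-outEdges⁺ src-e≡v (kept⁺ del-e)))

lemma1 : (N : Network) → Binary N → ReticulationVisible N →
    ∃[ del ] (ValidChoice N del × SpanningTree N del × NoDummyLeaves N del)
lemma1 N binary visible = del , valid-choice , spanning-tree , no-dummy-leaves
  where open Construction N binary visible
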